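{- Let $L$ be a residuated lattice, let $n\geq 1$ be an integer, and let $F_1$ and $F_2$ be filters of $L$ with $F_1\subseteq F_2$. If $F_1$ is an $n$-fold positive implicative filter of $L$, then so is $F_2$.
   Context: A residuated lattice is an algebra $(L,\wedge,\vee,\otimes,\rightarrow,0,1)$ such that $(L,\wedge,\vee,0,1)$ is a bounded lattice, $(L,\otimes,1)$ is a commutative monoid, and $x\otimes y\leq z$ iff $x\leq y\rightarrow z$. A filter of $L$ is a nonempty subset $F$ closed under $\otimes$ and upward closed. For $x\in L$, $x^n=x\otimes\cdots\otimes x$ ($n$ factors). A subset $F\subseteq L$ is an $n$-fold positive implicative filter if $1\in F$ and for all $x,y,z\in L$: if $x\rightarrow((y^n\rightarrow z)\rightarrow y)\in F$ and $x\in F$, then $y\in F$. -}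

module Defs where

open import Level using (Level; suc; _⊔_)
open import Data.Nat using (ℕ; zero) renaming (suc to sucℕ)
open import Data.Product using (_×_; Σ)
open import Relation.Binary.PropositionalEquality using (_≡_)
open import Relation.Unary using (Pred; _∈_; _⊆_)
open import Algebra.Lattice.Structures using (IsLattice)
open import Algebra.Structures using (IsCommutativeMonoid)

record ResiduatedLattice (a : Level) : Set (suc a) where
  infixr 6 _∨_
  infixr 7 _∧_
  infixr 8 _⊗_
  infixr 5 _⇒_
  field
    Carrier : Set a
    _∧_ _∨_ _⊗_ _⇒_ : Carrier → Carrier → Carrier
    𝟘 𝟙 : Carrier
    isLattice : IsLattice _≡_ _∨_ _∧_
    ⊗-isCommutativeMonoid : IsCommutativeMonoid _≡_ _⊗_ 𝟙

  _≤_ : Carrier → Carrier → Set a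
  x ≤ y = x ∧ y ≡ x

  field
    𝟘-least : ∀ x → 𝟘 ≤ x
    𝟙-greatest : ∀ x → x ≤ 𝟙
    residuation-⇒ : ∀ x y z → (x ⊗ y) ≤ z → x ≤ (y ⇒ z)
    residuation-⇐ : ∀ x y z → x ≤ (y ⇒ z) → (x ⊗ y) ≤ z

module _ {a : Level} (L : ResiduatedLattice a) where
  open ResiduatedLattice L

  _^_ : Carrier → ℕ → Carrier
  x ^ zero = 𝟙
  x ^ sucℕ n = x ⊗ (x ^ n)

  record IsFilter {ℓ : Level} (F : Pred Carrier ℓ) : Set (a ⊔ ℓ) where
    field
      nonempty : Σ Carrier (λ x → x ∈ F)
      ⊗-closed : ∀ {x y} → x ∈ F → y ∈ F → (x ⊗ y) ∈ F
      up-closed : ∀ {x y} → x ∈ F → x ≤ y → y ∈ F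

  record IsNFoldPosImplFilter {ℓ : Level} (n : ℕ) (F : Pred Carrier ℓ) : Set (a ⊔ ℓ) where
    field
      𝟙∈F : 𝟙 ∈ F
      pif : ∀ x y z → (x ⇒ (((y ^ n) ⇒ z) ⇒ y)) ∈ F → x ∈ F → y ∈ F

-- Given x ∈ F₂ and x → ((yⁿ → z) → y) ∈ F₂, put a = (yⁿ → z) → y and
-- u = a → y; then a ∈ F₂ by modus ponens. Since y ≤ u, one gets uⁿ → z ≤ yⁿ → z and
-- hence uⁿ → z ≤ a → y = u, so 1 → ((uⁿ → z) → u) = 1 lies in F₁. As F₁ is n-fold
-- positive implicative, u ∈ F₁ ⊆ F₂, and modus ponens with a ∈ F₂ gives y ∈ F₂.
module Submission where

open import Defs renaming (_^_ to power)
open import Level using (Level)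
open import Data.Nat using (ℕ; _≥_; zero; suc)
open import Relation.Unary using (Pred; _∈_; _⊆_)
open import Relation.Binary.PropositionalEquality using (_≡_; sym; subst; subst₂)
open import Relation.Binary.Bundles using (Poset)
open import Algebra.Lattice.Bundles using (Lattice)
open import Algebra.Lattice.Properties.Lattice using (poset)
open import Algebra.Structures using (IsCommutativeMonoid)

module ResiduatedLatticeProperties {c : Level} (L : ResiduatedLattice c) where
  open ResiduatedLattice L
  open IsCommutativeMonoid ⊗-isCommutativeMonoid using (comm; identityˡ; identityʳ)

  infix 9 _^_
  _^_ : Carrier → ℕ → Carrier
  _^_ = power L

  lattice : Lattice c c
  lattice = record { isLattice = isLattice }

  -- The library's natural order is x ≡ x ∧ y, the symmetric form of _≤_.
  private module ∧-Order = Poset (poset lattice)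

  ≤-refl : ∀ {x} → x ≤ x
  ≤-refl = sym ∧-Order.refl

  ≤-trans : ∀ {x y z} → x ≤ y → y ≤ z → x ≤ z
  ≤-trans p q = sym (∧-Order.trans (sym p) (sym q))

  ≤-antisym : ∀ {x y} → x ≤ y → y ≤ x → x ≡ y
  ≤-antisym p q = ∧-Order.antisym (sym p) (sym q)

  ⇒-eval : ∀ x y → (x ⊗ (x ⇒ y)) ≤ y
  ⇒-eval x y = subst (_≤ y) (comm (x ⇒ y) x) (residuation-⇐ (x ⇒ y) x y ≤-refl)

  ⊗-monoˡ-≤ : ∀ z {x y} → x ≤ y → (x ⊗ z) ≤ (y ⊗ z)
  ⊗-monoˡ-≤ z {x} {y} x≤y =
    residuation-⇐ x z (y ⊗ z) (≤-trans x≤y (residuation-⇒ y z (y ⊗ z) ≤-refl))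

  ⊗-monoʳ-≤ : ∀ z {x y} → x ≤ y → (z ⊗ x) ≤ (z ⊗ y)
  ⊗-monoʳ-≤ z {x} {y} x≤y =
    subst₂ _≤_ (comm x z) (comm y z) (⊗-monoˡ-≤ z x≤y)

  ⊗-mono-≤ : ∀ {x y u v} → x ≤ y → u ≤ v → (x ⊗ u) ≤ (y ⊗ v)
  ⊗-mono-≤ {y = y} {u = u} x≤y u≤v = ≤-trans (⊗-monoˡ-≤ u x≤y) (⊗-monoʳ-≤ y u≤v)

  ^-mono-≤ : ∀ n {x y} → x ≤ y → (x ^ n) ≤ (y ^ n)
  ^-mono-≤ zero    x≤y = ≤-refl
  ^-mono-≤ (suc n) x≤y = ⊗-mono-≤ x≤y (^-mono-≤ n x≤y)

  ⇒-antiˡ-≤ : ∀ z {x y} → x ≤ y → (y ⇒ z) ≤ (x ⇒ z)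
  ⇒-antiˡ-≤ z {x} {y} x≤y =
    residuation-⇒ (y ⇒ z) x z (subst (_≤ z) (comm x (y ⇒ z)) x⊗[y⇒z]≤z)
    where
    x⊗[y⇒z]≤z : (x ⊗ (y ⇒ z)) ≤ z
    x⊗[y⇒z]≤z = ≤-trans (⊗-monoˡ-≤ (y ⇒ z) x≤y) (⇒-eval y z)

  x⊗y≤x : ∀ x y → (x ⊗ y) ≤ x
  x⊗y≤x x y = subst ((x ⊗ y) ≤_) (identityʳ x) (⊗-monoʳ-≤ x (𝟙-greatest y))

  x≤y⇒x : ∀ x y → x ≤ (y ⇒ x)
  x≤y⇒x x y = residuation-⇒ x y x (x⊗y≤x x y)

  ≤⇒⇒≡𝟙 : ∀ {x y} → x ≤ y → (x ⇒ y) ≡ 𝟙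
  ≤⇒⇒≡𝟙 {x} {y} x≤y = sym (≤-antisym (residuation-⇒ 𝟙 x y 𝟙⊗x≤y) (𝟙-greatest _))
    where
    𝟙⊗x≤y : (𝟙 ⊗ x) ≤ y
    𝟙⊗x≤y = subst (_≤ y) (sym (identityˡ x)) x≤y

  ⇒⇒-pif-premise : ∀ n y z →
    let u = (((y ^ n) ⇒ z) ⇒ y) ⇒ y in ((u ^ n) ⇒ z) ≤ u
  ⇒⇒-pif-premise n y z = residuation-⇒ b a y b⊗a≤y
    where
    a = ((y ^ n) ⇒ z) ⇒ y
    b = ((a ⇒ y) ^ n) ⇒ z
    b≤yⁿ⇒z : b ≤ ((y ^ n) ⇒ z)
    b≤yⁿ⇒z = ⇒-antiˡ-≤ z (^-mono-≤ n (x≤y⇒x y a))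
    b⊗a≤y : (b ⊗ a) ≤ y
    b⊗a≤y = ≤-trans (⊗-monoˡ-≤ a b≤yⁿ⇒z) (⇒-eval ((y ^ n) ⇒ z) y)

module FilterProperties {c : Level} (L : ResiduatedLattice c) where
  open ResiduatedLattice L
  open ResiduatedLatticeProperties L

  ∈-mp : ∀ {ℓ} {F : Pred Carrier ℓ} → IsFilter L F → ∀ {x y} → x ∈ F → (x ⇒ y) ∈ F → y ∈ F
  ∈-mp isF {x} {y} x∈F x⇒y∈F = up-closed (⊗-closed x∈F x⇒y∈F) (⇒-eval x y)
    where open IsFilter isF

  pif-≤⇒∈ : ∀ {ℓ n} {F : Pred Carrier ℓ} → IsNFoldPosImplFilter L n F →
    ∀ y z → ((y ^ n) ⇒ z) ≤ y → y ∈ F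
  pif-≤⇒∈ {n = n} {F = F} isPIF y z le = pif 𝟙 y z (subst F (sym 𝟙⇒[…]≡𝟙) 𝟙∈F) 𝟙∈F
    where
    open IsNFoldPosImplFilter isPIF
    𝟙⇒[…]≡𝟙 : (𝟙 ⇒ ((y ^ n) ⇒ z) ⇒ y) ≡ 𝟙
    𝟙⇒[…]≡𝟙 = subst (λ t → (𝟙 ⇒ t) ≡ 𝟙) (sym (≤⇒⇒≡𝟙 le)) (≤⇒⇒≡𝟙 ≤-refl)

theorem5p6 : {a ℓ₁ ℓ₂ : Level} (L : ResiduatedLattice a) (n : ℕ) → n ≥ 1 →
    (F₁ : Pred (ResiduatedLattice.Carrier L) ℓ₁) (F₂ : Pred (ResiduatedLattice.Carrier L) ℓ₂) →
    IsFilter L F₁ → IsFilter L F₂ → F₁ ⊆ F₂ →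
    IsNFoldPosImplFilter L n F₁ → IsNFoldPosImplFilter L n F₂
theorem5p6 L n _ F₁ F₂ _ isF₂ F₁⊆F₂ isPIF₁ = record
  { 𝟙∈F = F₁⊆F₂ (IsNFoldPosImplFilter.𝟙∈F isPIF₁)
  ; pif = λ x y z x⇒a∈F₂ x∈F₂ →
      let a∈F₂ = ∈-mp isF₂ x∈F₂ x⇒a∈F₂
          a⇒y∈F₂ = F₁⊆F₂ (pif-≤⇒∈ isPIF₁ _ z (⇒⇒-pif-premise n y z))
      in ∈-mp isF₂ a∈F₂ a⇒y∈F₂
  }
  where
  open ResiduatedLatticeProperties L
  open FilterProperties L
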